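{- $1\mathrm{C}_{=}$ is not closed under complementation, i.e., $1\mathrm{C}_{=}\neq\mathrm{co}\text{ - }1\mathrm{C}_{=}$.
   Context: A one-way nondeterministic finite automaton (1nfa) is $M=(Q,\Sigma,\{\rhd,\lhd\},\delta,q_0,Q_{acc},Q_{rej})$: finite state set $Q$, input alphabet $\Sigma$, endmarkers $\rhd,\lhd\notin\Sigma$, disjoint sets $Q_{acc},Q_{rej}\subseteq Q$ ($Q_{halt}=Q_{acc}\cup Q_{rej}$), transition function $\delta:(Q-Q_{halt})\times(\Sigma\cup\{\rhd,\lhd\})\to\mathcal P(Q)$. On input $x$ it reads $\rhd x\lhd$ left to right, moving its head one cell right at every step (no $\lambda$-moves), halting on entering a halting state. A path is accepting (resp. rejecting) if it enters $Q_{acc}$ (resp. $Q_{rej}$), otherwise neither. $\#M(x)$, $\#\overline{M}(x)$ are the numbers of accepting and rejecting paths on $x$. A family $\{M_n\}_{n\in\mathbb N}$ has polynomial size if $|Q_n|\le p(n)$ for a fixed polynomial $p$. A family of promise problems over a fixed alphabet $\Sigma$ is $\mathcal L=\{(L_n^{(+)},L_n^{(-)})\}_{n\in\mathbb N}$ with $L_n^{(+)},L_n^{(-)}\subseteq\Sigma^*$ disjoint; $\mathrm{co}\text{ - }\mathcal L=\{(L_n^{(-)},L_n^{(+)})\}_n$ and $\mathrm{co}\text{ - }\mathcal C=\{\mathrm{co}\text{ - }\mathcal L:\mathcal L\in\mathcal C\}$. A family of partial functions is $\{(f_n,D_n)\}_n$, $D_n\subseteq\Sigma^*$. $1\mathrm{Gap}$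 is the class of such families for which a polynomial-size family of 1nfa's satisfies $f_n(x)=\#M_n(x)-\#\overline{M}_n(x)$ for all $n$, $x\in D_n$. $\mathcal L\in1\mathrm C_{=}$ iff some $\{(f_n,D_n)\}\in1\mathrm{Gap}$ has $L_n^{(+)}\cup L_n^{(-)}\subseteq D_n$, $f_n=0$ on $L_n^{(+)}$ and $f_n\ne0$ on $L_n^{(-)}$ for all $n$. -}

module Defs where

open import Data.Nat using (ℕ; zero; suc; _+_; _*_; _≤_)
open import Data.Integer using (ℤ; +_; _-_)
open import Data.Fin using (Fin)
open import Data.List using (List; []; _∷_; map; _++_; allFin)
open import Data.Nat.ListAction using (sum)
open import Data.Bool using (Bool; true; false; if_then_else_)
open import Data.Product using (Σ; _×_; ∃; ∃-syntax)
open import Relation.Binary.PropositionalEquality using (_≡_)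
open import Relation.Nullary using (¬_)
open import Data.Empty using (⊥)

data Tape (k : ℕ) : Set where
  ▷   : Tape k
  sym : Fin k → Tape k
  ◁   : Tape k

-- Classification of states: accepting, rejecting, or non-halting.
-- (This makes Q_acc and Q_rej disjoint by construction.)
data Kind : Set where
  acc rej non : Kind

-- A 1nfa over alphabet Fin k with state set Fin m.
-- δ q σ q' = true  iff  q' ∈ δ(q,σ).  δ is only consulted on non-halting q.
record NFA (k : ℕ) : Set where
  field
    m     : ℕ
    q₀    : Fin m
    kind  : Fin m → Kind
    δ     : Fin m → Tape k → Fin m → Bool

-- A path halts as soon as it is in a
-- halting state; if it reads past ◁ without halting it is neither.
module Count {k : ℕ} (M : NFA k) where
  open NFA M

  hit : Kind → Kind → ℕ
  hit acc acc = 1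
  hit rej rej = 1
  hit _   _   = 0

  countFrom : Kind → Fin m → List (Tape k) → ℕ
  countFrom t q w with kind q
  ... | acc = hit t acc
  ... | rej = hit t rej
  countFrom t q []      | non = 0
  countFrom t q (σ ∷ w) | non =
    sum (map (λ q' → if δ q σ q' then countFrom t q' w else 0) (allFin m))

tape : ∀ {k} → List (Fin k) → List (Tape k)
tape x = ▷ ∷ (map sym x ++ (◁ ∷ []))

#acc : ∀ {k} → NFA k → List (Fin k) → ℕ
#acc M x = Count.countFrom M acc (NFA.q₀ M) (tape x)

#rej : ∀ {k} → NFA k → List (Fin k) → ℕ
#rej M x = Count.countFrom M rej (NFA.q₀ M) (tape x)

gap : ∀ {k} → NFA k → List (Fin k) → ℤ
gap M x = + #acc M x - + #rej M x

-- Polynomials with natural-number coefficients (constant term first).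
evalPoly : List ℕ → ℕ → ℕ
evalPoly []       n = 0
evalPoly (c ∷ cs) n = c + n * evalPoly cs n

PolySize : ∀ {k} → (ℕ → NFA k) → Set
PolySize M = ∃[ p ] (∀ n → NFA.m (M n) ≤ evalPoly p n)

record PartialFamily (k : ℕ) : Set₁ where
  field
    f : ℕ → List (Fin k) → ℤ
    D : ℕ → List (Fin k) → Set

In1Gap : ∀ {k} → PartialFamily k → Set
In1Gap {k} F = ∃[ M ] (PolySize {k} M ×
  (∀ n x → PartialFamily.D F n x → PartialFamily.f F n x ≡ gap (M n) x))

record PromiseFamily (k : ℕ) : Set₁ where
  field
    L⁺ : ℕ → List (Fin k) → Set
    L⁻ : ℕ → List (Fin k) → Set
    disjoint : ∀ n x → L⁺ n x → L⁻ n x → ⊥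

co : ∀ {k} → PromiseFamily k → PromiseFamily k
co L = record { L⁺ = PromiseFamily.L⁻ L ; L⁻ = PromiseFamily.L⁺ L
              ; disjoint = λ n x a b → PromiseFamily.disjoint L n x b a }

In1C= : ∀ {k} → PromiseFamily k → Set₁
In1C= {k} L = ∃[ F ] (In1Gap {k} F ×
  (∀ n x → PromiseFamily.L⁺ L n x → PartialFamily.D F n x) ×
  (∀ n x → PromiseFamily.L⁻ L n x → PartialFamily.D F n x) ×
  (∀ n x → PromiseFamily.L⁺ L n x → PartialFamily.f F n x ≡ + 0) ×
  (∀ n x → PromiseFamily.L⁻ L n x → ¬ (PartialFamily.f F n x ≡ + 0)))

InCo1C= : ∀ {k} → PromiseFamily k → Set₁
InCo1C= {k} L = ∃[ L' ] (In1C= {k} L' × co L' ≡ L)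

-- Take the automaton M₀ with gap(aⁱbaʲ) = i − j; its zero-gap promise problem is in 1C₌.
-- If the complement were in 1C₌ via an automaton M with m states, the integer matrix
-- G(i, j) = gap_M(aⁱbaʲ) would be zero off the diagonal and nonzero on it. But splitting
-- every computation of M at the boundary between aⁱb and aʲ writes G as a sum of m + 1
-- rank-one matrices (one for paths halting inside aⁱb, one per state reached there),
-- while an (m + 2) × (m + 2) nonsingular diagonal block needs at least m + 2 of them.
module Submission where

open import Defs renaming (sym to symbol)
open import Algebra.Properties.CommutativeSemigroup using (interchange)
open import Data.Bool using (Bool; true; false; if_then_else_)
open import Data.Fin using (Fin; zero; suc)
open import Data.Integer as ℤ using (ℤ; +_; 0ℤ; _≟_)
import Data.Integer.Properties as ℤP
open import Data.Integer.Properties using (i*j≡0⇒i≡0∨j≡0; pos-+; pos-*; i-j≡0⇒i≡j; i≡j⇒i-j≡0; +-injective)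
open import Data.Integer.Tactic.RingSolver using (solve-∀)
open import Data.List using (List; []; _∷_; _++_; map; length; allFin; replicate)
open import Data.List.Membership.Propositional using (find)
open import Data.List.Membership.Propositional.Properties using (∈-∃++)
open import Data.List.Properties using (map-cong; map-++; ++-assoc; length-map; length-++-sucʳ; length-tabulate)
open import Data.List.Relation.Unary.All using (All; []; _∷_)
open import Data.List.Relation.Unary.All.Properties using (¬All⇒Any¬)
open import Data.Nat as ℕ using (ℕ; zero; suc; _≤_; _<_; z≤n; s≤s)
open import Data.Nat.ListAction using (sum)
open import Data.Nat.Properties
  using (+-identityʳ; *-identityʳ; *-zeroʳ; +-comm; *-distribʳ-+; +-commutativeSemigroup;
         m≤m+n; n<1+n; m<n⇒m<1+n; >⇒≢; <-irrefl)
open import Data.Product using (_×_; _,_; proj₁; ∃₂; ∃-syntax)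
open import Data.Sum using ([_,_]′)
open import Data.Unit using (⊤; tt)
open import Function using (_∘_)
open import Relation.Binary.PropositionalEquality
open import Relation.Nullary using (¬_)

open ≡-Reasoning

private variable A B : Set

module _ where
  open import Data.Nat using (_+_; _*_)

  sum-map-zero : (xs : List A) → sum (map (λ _ → 0) xs) ≡ 0
  sum-map-zero []       = refl
  sum-map-zero (_ ∷ xs) = sum-map-zero xs

  sum-map-+ : (xs : List A) (f g : A → ℕ) →
              sum (map (λ x → f x + g x) xs) ≡ sum (map f xs) + sum (map g xs)
  sum-map-+ []       f g = refl
  sum-map-+ (x ∷ xs) f g =
    trans (cong (_+_ (f x + g x)) (sum-map-+ xs f g))
          (interchange +-commutativeSemigroup (f x) (g x) (sum (map f xs)) (sum (map g xs)))

  sum-map-*ʳ : (xs : List A) (f : A → ℕ) (c : ℕ) →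
               sum (map f xs) * c ≡ sum (map (λ x → f x * c) xs)
  sum-map-*ʳ []       f c = refl
  sum-map-*ʳ (x ∷ xs) f c =
    trans (*-distribʳ-+ c (f x) (sum (map f xs))) (cong (_+_ (f x * c)) (sum-map-*ʳ xs f c))

  sum-map-swap : (xs : List A) (ys : List B) (h : A → B → ℕ) →
                 sum (map (λ x → sum (map (h x) ys)) xs) ≡ sum (map (λ y → sum (map (λ x → h x y) xs)) ys)
  sum-map-swap []       ys h = sym (sum-map-zero ys)
  sum-map-swap (x ∷ xs) ys h =
    trans (cong (_+_ (sum (map (h x) ys))) (sum-map-swap xs ys h))
          (sym (sum-map-+ ys (h x) (λ y → sum (map (λ x → h x y) xs))))

module _ where
  open import Data.Integer using (_+_; _*_; _-_)

  pos-+-minus : ∀ a b c d → + (a ℕ.+ b) - + (c ℕ.+ d) ≡ (+ a - + c) + (+ b - + d)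
  pos-+-minus a b c d = begin
    + (a ℕ.+ b) - + (c ℕ.+ d)  ≡⟨ cong₂ _-_ (pos-+ a b) (pos-+ c d) ⟩
    (+ a + + b) - (+ c + + d)  ≡⟨ regroup (+ a) (+ b) (+ c) (+ d) ⟩
    (+ a - + c) + (+ b - + d)  ∎
    where
    regroup : ∀ a b c d → (a + b) - (c + d) ≡ (a - c) + (b - d)
    regroup = solve-∀

  -- A dyad (a , b) stands for the rank-one matrix (i , j) ↦ a i * b j.
  Dyad : Set
  Dyad = (ℕ → ℤ) × (ℕ → ℤ)

  dyadSum : List Dyad → ℕ → ℕ → ℤ
  dyadSum []             i j = 0ℤ
  dyadSum ((a , b) ∷ ds) i j = a i * b j + dyadSum ds i j

  record NonsingularDiagonal (N : ℕ) (f : ℕ → ℕ → ℤ) : Set where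
    field
      off-diagonal : ∀ {i j} → i < N → j < N → i ≢ j → f i j ≡ 0ℤ
      on-diagonal  : ∀ {i} → i < N → f i i ≢ 0ℤ

  open NonsingularDiagonal

  NonsingularDiagonal-cong : ∀ {N f g} → (∀ i j → f i j ≡ g i j) →
                             NonsingularDiagonal N f → NonsingularDiagonal N g
  NonsingularDiagonal-cong f≡g D = record
    { off-diagonal = λ {i} {j} i<N j<N i≢j → trans (sym (f≡g i j)) (off-diagonal D i<N j<N i≢j)
    ; on-diagonal  = λ {i} i<N → on-diagonal D i<N ∘ trans (f≡g i i)
    }

  -- One step of Gaussian elimination with pivot row N.
  NonsingularDiagonal-eliminate : ∀ {N f} (a : ℕ → ℤ) → a N ≢ 0ℤ → NonsingularDiagonal (suc N) f →
    NonsingularDiagonal N (λ u v → a N * f u v - a u * f N v)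
  NonsingularDiagonal-eliminate {N} {f} a aN≢0 D = record
    { off-diagonal = λ {u} {v} u<N v<N u≢v → begin
        a N * f u v - a u * f N v
          ≡⟨ cong₂ (λ x y → a N * x - a u * y) (off-diagonal D (widen u<N) (widen v<N) u≢v) (pivotRow v<N) ⟩
        a N * 0ℤ - a u * 0ℤ
          ≡⟨ times-zeros (a N) (a u) ⟩
        0ℤ ∎
    ; on-diagonal = λ {u} u<N g≡0 →
        let aN*f≡0 = trans (minus-zero (a N * f u u) (a u))
                           (trans (cong (λ y → a N * f u u - a u * y) (sym (pivotRow u<N))) g≡0)
        in  [ aN≢0 , on-diagonal D (widen u<N) ]′ (i*j≡0⇒i≡0∨j≡0 (a N) aN*f≡0)
    }
    where
    widen : ∀ {u} → u < N → u < suc N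
    widen = m<n⇒m<1+n
    pivotRow : ∀ {v} → v < N → f N v ≡ 0ℤ
    pivotRow v<N = off-diagonal D (n<1+n N) (widen v<N) (>⇒≢ v<N)
    times-zeros : ∀ x y → x * 0ℤ - y * 0ℤ ≡ 0ℤ
    times-zeros = solve-∀
    minus-zero : ∀ x y → x ≡ x - y * 0ℤ
    minus-zero = solve-∀

  eliminate : ℕ → (ℕ → ℤ) → Dyad → Dyad
  eliminate p a (a′ , b′) = (λ u → a p * a′ u - a u * a′ p) , b′

  dyadSum-eliminate : ∀ p a ds u v →
    dyadSum (map (eliminate p a) ds) u v ≡ a p * dyadSum ds u v - a u * dyadSum ds p v
  dyadSum-eliminate p a []               u v = sym (times-zeros (a p) (a u))
    where
    times-zeros : ∀ x y → x * 0ℤ - y * 0ℤ ≡ 0ℤ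
    times-zeros = solve-∀
  dyadSum-eliminate p a ((a′ , b′) ∷ ds) u v =
    trans (cong (_+_ ((a p * a′ u - a u * a′ p) * b′ v)) (dyadSum-eliminate p a ds u v))
          (distribute (a p) (a u) (a′ u) (a′ p) (b′ v) (dyadSum ds u v) (dyadSum ds p v))
    where
    distribute : ∀ x y z w s g h → (x * z - y * w) * s + (x * g - y * h) ≡ x * (z * s + g) - y * (w * s + h)
    distribute = solve-∀

  dyadSum-insert : ∀ pre a b post i j →
    dyadSum (pre ++ (a , b) ∷ post) i j ≡ a i * b j + dyadSum (pre ++ post) i j
  dyadSum-insert []                 a b post i j = refl
  dyadSum-insert ((a′ , b′) ∷ pre) a b post i j =
    trans (cong (_+_ (a′ i * b′ j)) (dyadSum-insert pre a b post i j))
          (swap (a′ i * b′ j) (a i * b j) (dyadSum (pre ++ post) i j))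
    where
    swap : ∀ x y z → x + (y + z) ≡ y + (x + z)
    swap = solve-∀

  -- Eliminating with a dyad (a , b) of the sum itself cancels it, so one dyad fewer suffices.
  dyadSum-eliminate-pivot : ∀ pre a b post p u v →
    dyadSum (map (eliminate p a) (pre ++ post)) u v
      ≡ a p * dyadSum (pre ++ (a , b) ∷ post) u v - a u * dyadSum (pre ++ (a , b) ∷ post) p v
  dyadSum-eliminate-pivot pre a b post p u v = begin
    dyadSum (map (eliminate p a) rest) u v
      ≡⟨ dyadSum-eliminate p a rest u v ⟩
    a p * dyadSum rest u v - a u * dyadSum rest p v
      ≡⟨ cancel (a p) (a u) (b v) (dyadSum rest u v) (dyadSum rest p v) ⟩
    a p * (a u * b v + dyadSum rest u v) - a u * (a p * b v + dyadSum rest p v)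
      ≡⟨ cong₂ (λ x y → a p * x - a u * y) (dyadSum-insert pre a b post u v) (dyadSum-insert pre a b post p v) ⟨
    a p * dyadSum (pre ++ (a , b) ∷ post) u v - a u * dyadSum (pre ++ (a , b) ∷ post) p v ∎
    where
    rest : List Dyad
    rest = pre ++ post
    cancel : ∀ x y z g h → x * g - y * h ≡ x * (y * z + g) - y * (x * z + h)
    cancel = solve-∀

  dyadSum-zeroRow : ∀ p ds v → All (λ d → proj₁ d p ≡ 0ℤ) ds → dyadSum ds p v ≡ 0ℤ
  dyadSum-zeroRow p []             v []            = refl
  dyadSum-zeroRow p ((a , b) ∷ ds) v (ap≡0 ∷ ds≡0) =
    trans (cong₂ (λ x y → x * b v + y) ap≡0 (dyadSum-zeroRow p ds v ds≡0)) (zero-term (b v))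
    where
    zero-term : ∀ x → 0ℤ * x + 0ℤ ≡ 0ℤ
    zero-term = solve-∀

  pivot : ∀ p ds → dyadSum ds p p ≢ 0ℤ →
    ∃₂ λ pre post → ∃₂ λ a b → ds ≡ pre ++ (a , b) ∷ post × a p ≢ 0ℤ
  pivot p ds dsₚₚ≢0
    with (a , b) , d∈ds , ap≢0
           ← find (¬All⇒Any¬ (λ d → proj₁ d p ≟ 0ℤ) ds (dsₚₚ≢0 ∘ dyadSum-zeroRow p ds p))
    with pre , post , ds≡ ← ∈-∃++ d∈ds
    = pre , post , a , b , ds≡ , ap≢0

  NonsingularDiagonal⇒≤length : ∀ N ds → NonsingularDiagonal N (dyadSum ds) → N ≤ length ds
  NonsingularDiagonal⇒≤length zero    ds D = z≤n
  NonsingularDiagonal⇒≤length (suc N) ds D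
    with pre , post , a , b , refl , aN≢0 ← pivot N ds (on-diagonal D (n<1+n N)) =
    subst (suc N ≤_) length-reduced (s≤s (NonsingularDiagonal⇒≤length N reduced reduced-diagonal))
    where
    reduced : List Dyad
    reduced = map (eliminate N a) (pre ++ post)
    reduced-diagonal : NonsingularDiagonal N (dyadSum reduced)
    reduced-diagonal = NonsingularDiagonal-cong (λ u v → sym (dyadSum-eliminate-pivot pre a b post N u v))
                                                (NonsingularDiagonal-eliminate a aN≢0 D)
    length-reduced : suc (length reduced) ≡ length (pre ++ (a , b) ∷ post)
    length-reduced = trans (cong suc (length-map (eliminate N a) (pre ++ post))) (sym (length-++-sucʳ pre (a , b) post))

-- countWithin and paths split a computation on σ ∷ u ++ w at the boundary between u and w:
-- paths halting while reading σ ∷ u, and paths still running in state q′ after it.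
module Paths {k : ℕ} (M : NFA k) where
  open import Data.Nat using (_+_; _*_)
  open NFA M
  open Count M

  countWithin : Kind → Fin m → Tape k → List (Tape k) → ℕ
  countWithin t q σ u with kind q
  ... | acc = hit t acc
  ... | rej = hit t rej
  countWithin t q σ []       | non = 0
  countWithin t q σ (σ′ ∷ u) | non =
    sum (map (λ q′ → if δ q σ q′ then countWithin t q′ σ′ u else 0) (allFin m))

  paths : Fin m → Tape k → List (Tape k) → Fin m → ℕ
  paths q σ u q′ with kind q
  ... | acc = 0
  ... | rej = 0
  paths q σ []       q′ | non = if δ q σ q′ then 1 else 0
  paths q σ (σ′ ∷ u) q″ | non =
    sum (map (λ q′ → if δ q σ q′ then paths q′ σ′ u q″ else 0) (allFin m))

  countFrom-++ : ∀ t q σ u w → countFrom t q (σ ∷ u ++ w)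
    ≡ countWithin t q σ u + sum (map (λ q′ → paths q σ u q′ * countFrom t q′ w) (allFin m))
  countFrom-++ t q σ u w with kind q
  ... | acc = sym (trans (cong (_+_ (hit t acc)) (sum-map-zero (allFin m))) (+-identityʳ _))
  ... | rej = sym (trans (cong (_+_ (hit t rej)) (sum-map-zero (allFin m))) (+-identityʳ _))
  countFrom-++ t q σ [] w | non = cong sum (map-cong gate (allFin m))
    where
    gate : ∀ q′ → (if δ q σ q′ then countFrom t q′ w else 0)
                  ≡ (if δ q σ q′ then 1 else 0) * countFrom t q′ w
    gate q′ with δ q σ q′
    ... | true  = sym (+-identityʳ _)
    ... | false = refl
  countFrom-++ t q σ (σ′ ∷ u) w | non = begin
    sum (map (λ q′ → gated q′ (countFrom t q′ (σ′ ∷ u ++ w))) Q)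
      ≡⟨ cong sum (map-cong split Q) ⟩
    sum (map (λ q′ → gated q′ (countWithin t q′ σ′ u) + sum (map (λ q″ → continue q′ q″) Q)) Q)
      ≡⟨ sum-map-+ Q _ _ ⟩
    within + sum (map (λ q′ → sum (map (continue q′) Q)) Q)
      ≡⟨ cong (_+_ within) (sum-map-swap Q Q continue) ⟩
    within + sum (map (λ q″ → sum (map (λ q′ → continue q′ q″) Q)) Q)
      ≡⟨ cong (_+_ within) (cong sum (map-cong factor Q)) ⟩
    within + sum (map (λ q″ → reach q″ * countFrom t q″ w) Q) ∎
    where
    Q : List (Fin m)
    Q = allFin m
    gated : Fin m → ℕ → ℕ
    gated q′ x = if δ q σ q′ then x else 0
    within : ℕ
    within = sum (map (λ q′ → gated q′ (countWithin t q′ σ′ u)) Q)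
    reach : Fin m → ℕ
    reach q″ = sum (map (λ q′ → gated q′ (paths q′ σ′ u q″)) Q)
    continue : Fin m → Fin m → ℕ
    continue q′ q″ = gated q′ (paths q′ σ′ u q″) * countFrom t q″ w
    split : ∀ q′ → gated q′ (countFrom t q′ (σ′ ∷ u ++ w))
                 ≡ gated q′ (countWithin t q′ σ′ u) + sum (map (continue q′) Q)
    split q′ with δ q σ q′
    ... | true  = countFrom-++ t q′ σ′ u w
    ... | false = sym (sum-map-zero Q)
    factor : ∀ q″ → sum (map (λ q′ → continue q′ q″) Q) ≡ reach q″ * countFrom t q″ w
    factor q″ = sym (sum-map-*ʳ Q (λ q′ → gated q′ (paths q′ σ′ u q″)) (countFrom t q″ w))

module _ where
  open import Data.Integer using (_+_; _*_; _-_)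

  tape-++ : ∀ {k} (x y : List (Fin k)) → tape (x ++ y) ≡ ▷ ∷ map symbol x ++ map symbol y ++ ◁ ∷ []
  tape-++ x y = cong (▷ ∷_) (trans (cong (_++ ◁ ∷ []) (map-++ symbol x y))
                                   (++-assoc (map symbol x) (map symbol y) (◁ ∷ [])))

  dyadSum-map-pos : (xs : List A) (r : ℕ → A → ℕ) (f g : A → ℕ → ℕ) (i j : ℕ) →
    dyadSum (map (λ x → (λ i → + r i x) , (λ j → + f x j - + g x j)) xs) i j
      ≡ + sum (map (λ x → r i x ℕ.* f x j) xs) - + sum (map (λ x → r i x ℕ.* g x j) xs)
  dyadSum-map-pos []       r f g i j = refl
  dyadSum-map-pos (x ∷ xs) r f g i j = begin
    + r i x * (+ f x j - + g x j) + dyadSum (map _ xs) i j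
      ≡⟨ cong₂ _+_ head-term (dyadSum-map-pos xs r f g i j) ⟩
    (+ (r i x ℕ.* f x j) - + (r i x ℕ.* g x j)) + (+ F - + G)
      ≡⟨ pos-+-minus (r i x ℕ.* f x j) F (r i x ℕ.* g x j) G ⟨
    + (r i x ℕ.* f x j ℕ.+ F) - + (r i x ℕ.* g x j ℕ.+ G) ∎
    where
    F G : ℕ
    F = sum (map (λ x → r i x ℕ.* f x j) xs)
    G = sum (map (λ x → r i x ℕ.* g x j) xs)
    distribute : ∀ a b c → a * (b - c) ≡ a * b - a * c
    distribute = solve-∀
    head-term : + r i x * (+ f x j - + g x j) ≡ + (r i x ℕ.* f x j) - + (r i x ℕ.* g x j)
    head-term = trans (distribute (+ r i x) (+ f x j) (+ g x j))
                      (sym (cong₂ _-_ (pos-* (r i x) (f x j)) (pos-* (r i x) (g x j))))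

  gap-dyads : ∀ {k} (M : NFA k) (u v : ℕ → List (Fin k)) →
    ∃[ ds ] length ds ≡ suc (NFA.m M) × (∀ i j → dyadSum ds i j ≡ gap M (u i ++ v j))
  gap-dyads M u v = ds , cong suc (trans (length-map _ (allFin m)) (length-tabulate _)) , ds≡gap
    where
    open NFA M
    open Count M
    open Paths M
    U V : ℕ → List (Tape _)
    U i = map symbol (u i)
    V j = map symbol (v j) ++ ◁ ∷ []
    reach : ℕ → Fin m → ℕ
    reach i q = paths q₀ ▷ (U i) q
    suffix : Kind → Fin m → ℕ → ℕ
    suffix t q j = countFrom t q (V j)
    within : Kind → ℕ → ℕ
    within t i = countWithin t q₀ ▷ (U i)
    ds : List Dyad
    ds = ((λ i → + within acc i - + within rej i) , λ _ → + 1)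
         ∷ map (λ q → (λ i → + reach i q) , (λ j → + suffix acc q j - + suffix rej q j)) (allFin m)
    ds≡gap : ∀ i j → dyadSum ds i j ≡ gap M (u i ++ v j)
    ds≡gap i j = begin
      (+ within acc i - + within rej i) * + 1 + dyadSum (map _ (allFin m)) i j
        ≡⟨ cong₂ _+_ (ℤP.*-identityʳ (+ within acc i - + within rej i))
                     (dyadSum-map-pos (allFin m) reach (suffix acc) (suffix rej) i j) ⟩
      (+ within acc i - + within rej i) + (+ through acc - + through rej)
        ≡⟨ pos-+-minus (within acc i) (through acc) (within rej i) (through rej) ⟨
      + (within acc i ℕ.+ through acc) - + (within rej i ℕ.+ through rej)
        ≡⟨ cong₂ (λ x y → + x - + y) (countFrom-++ acc q₀ ▷ (U i) (V j))
                                      (countFrom-++ rej q₀ ▷ (U i) (V j)) ⟨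
      + countFrom acc q₀ (▷ ∷ U i ++ V j) - + countFrom rej q₀ (▷ ∷ U i ++ V j)
        ≡⟨ cong (λ w → + countFrom acc q₀ w - + countFrom rej q₀ w) (tape-++ (u i) (v j)) ⟨
      gap M (u i ++ v j) ∎
      where
      through : Kind → ℕ
      through t = sum (map (λ q → reach i q ℕ.* suffix t q j) (allFin m))

-- The witness automaton: the branch through `before` accepts once for every a in front of
-- the b, the branch through `waiting` and `after` rejects once for every a behind it.
module _ where
  open import Data.Nat using (_+_; _*_)

  pattern start   = zero
  pattern before  = suc zero
  pattern waiting = suc (suc zero)
  pattern after   = suc (suc (suc zero))
  pattern accept  = suc (suc (suc (suc zero)))
  pattern reject  = suc (suc (suc (suc (suc zero))))

  pattern a = zero
  pattern b = suc zero

  δ₀ : Fin 6 → Tape 2 → Fin 6 → Bool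
  δ₀ start   ▷          before  = true
  δ₀ start   ▷          waiting = true
  δ₀ before  (symbol a) before  = true
  δ₀ before  (symbol a) accept  = true
  δ₀ waiting (symbol a) waiting = true
  δ₀ waiting (symbol b) after   = true
  δ₀ after   (symbol a) after   = true
  δ₀ after   (symbol a) reject  = true
  δ₀ _       _          _       = false

  kind₀ : Fin 6 → Kind
  kind₀ accept = acc
  kind₀ reject = rej
  kind₀ _      = non

  M₀ : NFA 2
  M₀ = record { m = 6 ; q₀ = start ; kind = kind₀ ; δ = δ₀ }

  aⁱb aʲ : ℕ → List (Fin 2)
  aⁱb i = replicate i a ++ b ∷ []
  aʲ  j = replicate j a

  open Count M₀

  unread : List (Fin 2) → List (Tape 2)
  unread x = map symbol x ++ ◁ ∷ []

  count-after : ∀ t j → countFrom t after (unread (aʲ j)) ≡ j * hit t rej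
  count-after t zero    = refl
  count-after t (suc j) = begin
    countFrom t after (unread (aʲ j)) + (hit t rej + 0) ≡⟨ cong₂ _+_ (count-after t j) (+-identityʳ (hit t rej)) ⟩
    j * hit t rej + hit t rej                           ≡⟨ +-comm (j * hit t rej) (hit t rej) ⟩
    suc j * hit t rej                                   ∎

  count-waiting : ∀ t i j → countFrom t waiting (unread (aⁱb i ++ aʲ j)) ≡ j * hit t rej
  count-waiting t zero    j = trans (+-identityʳ _) (count-after t j)
  count-waiting t (suc i) j = trans (+-identityʳ _) (count-waiting t i j)

  count-before : ∀ t i j → countFrom t before (unread (aⁱb i ++ aʲ j)) ≡ i * hit t acc
  count-before t zero    j = refl
  count-before t (suc i) j = begin
    countFrom t before (unread (aⁱb i ++ aʲ j)) + (hit t acc + 0) ≡⟨ cong₂ _+_ (count-before t i j) (+-identityʳ (hit t acc)) ⟩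
    i * hit t acc + hit t acc                                   ≡⟨ +-comm (i * hit t acc) (hit t acc) ⟩
    suc i * hit t acc                                           ∎

  count-M₀ : ∀ t i j → countFrom t start (tape (aⁱb i ++ aʲ j)) ≡ i * hit t acc + j * hit t rej
  count-M₀ t i j = cong₂ _+_ (count-before t i j) (trans (+-identityʳ _) (count-waiting t i j))

  gap-M₀ : ∀ i j → gap M₀ (aⁱb i ++ aʲ j) ≡ + i ℤ.- + j
  gap-M₀ i j = cong₂ (λ x y → + x ℤ.- + y) (trans (count-M₀ acc i j) accepting)
                                            (trans (count-M₀ rej i j) rejecting)
    where
    accepting : i * 1 + j * 0 ≡ i
    accepting = trans (cong₂ _+_ (*-identityʳ i) (*-zeroʳ j)) (+-identityʳ i)
    rejecting : i * 0 + j * 1 ≡ j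
    rejecting = trans (cong (λ x → x + j * 1) (*-zeroʳ i)) (*-identityʳ j)

  gap-M₀≡0 : ∀ i → gap M₀ (aⁱb i ++ aʲ i) ≡ 0ℤ
  gap-M₀≡0 i = trans (gap-M₀ i i) (i≡j⇒i-j≡0 {+ i} refl)

  gap-M₀≢0 : ∀ {i j} → i ≢ j → gap M₀ (aⁱb i ++ aʲ j) ≢ 0ℤ
  gap-M₀≢0 {i} {j} i≢j gap≡0 = i≢j (+-injective (i-j≡0⇒i≡j (+ i) (+ j) (trans (sym (gap-M₀ i j)) gap≡0)))

ZeroGap : PromiseFamily 2
ZeroGap = record
  { L⁺       = λ _ x → gap M₀ x ≡ 0ℤ
  ; L⁻       = λ _ x → gap M₀ x ≢ 0ℤ
  ; disjoint = λ _ _ gap≡0 gap≢0 → gap≢0 gap≡0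
  }

ZeroGap∈1C= : In1C= ZeroGap
ZeroGap∈1C= = record { f = λ _ → gap M₀ ; D = λ _ _ → ⊤ }
            , ((λ _ → M₀) , (6 ∷ [] , λ n → m≤m+n 6 (n ℕ.* 0)) , λ _ _ _ → refl)
            , (λ _ _ _ → tt) , (λ _ _ _ → tt) , (λ _ _ gap≡0 → gap≡0) , (λ _ _ gap≢0 → gap≢0)

-- The promise does not depend on n, so the automaton of the family for n = 0 suffices.
co-ZeroGap∈1C=⇒diagonal : InCo1C= ZeroGap →
  ∃[ M ] (∀ N → NonsingularDiagonal N (λ i j → gap M (aⁱb i ++ aʲ j)))
co-ZeroGap∈1C=⇒diagonal (_ , (_ , (Ms , _ , f≡gap) , D⁺ , D⁻ , f≡0 , f≢0) , coL≡ZeroGap) =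
  Ms 0 , λ _ → record
    { off-diagonal = λ {i} {j} _ _ i≢j →
        let x∈L⁺ = subst (λ P → P 0 (aⁱb i ++ aʲ j)) (sym (cong L⁻ coL≡ZeroGap)) (gap-M₀≢0 i≢j)
        in  trans (sym (f≡gap 0 _ (D⁺ 0 _ x∈L⁺))) (f≡0 0 _ x∈L⁺)
    ; on-diagonal = λ {i} _ →
        let x∈L⁻ = subst (λ P → P 0 (aⁱb i ++ aʲ i)) (sym (cong L⁺ coL≡ZeroGap)) (gap-M₀≡0 i)
        in  f≢0 0 _ x∈L⁻ ∘ trans (f≡gap 0 _ (D⁻ 0 _ x∈L⁻))
    }
  where open PromiseFamily

corollary4p7 : ¬ (∀ (k : ℕ) (L : PromiseFamily k) → In1C= L → InCo1C= L)
corollary4p7 closed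
  with M , diagonal ← co-ZeroGap∈1C=⇒diagonal (closed 2 ZeroGap ZeroGap∈1C=)
  with ds , length≡1+m , ds≡gap ← gap-dyads M aⁱb aʲ
  = <-irrefl refl (subst (2 ℕ.+ NFA.m M ≤_) length≡1+m (NonsingularDiagonal⇒≤length _ ds ds-diagonal))
  where
  ds-diagonal : NonsingularDiagonal (2 ℕ.+ NFA.m M) (dyadSum ds)
  ds-diagonal = NonsingularDiagonal-cong (λ i j → sym (ds≡gap i j)) (diagonal _)
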